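{- The map $\mathrm{Pal}:F_2\to F_2$ is continuous for the profinite topology on $F_2$.
   Context: $F_2$ is the free group on $a,b$. $w\mapsto R_w$ is the group homomorphism $F_2\to\mathrm{Aut}(F_2)$ with $R_a(a)=a$, $R_a(b)=ba$, $R_b(a)=ab$, $R_b(b)=b$. The palindromization map $\mathrm{Pal}:F_2\to F_2$ is defined by $\mathrm{Pal}(w)=b^{ -1}a^{ -1}R_w(ab)$. The profinite topology on $F_2$ is the coarsest topology such that every group homomorphism from $F_2$ to a finite (discrete) group is continuous. -}

module Defs where

open import Level using (0ℓ)
open import Data.Bool using (Bool; true; false; T; not; _∧_; _xor_; if_then_else_)
open import Data.Bool.Properties using (T-∧)
open import Data.Unit using (⊤; tt)
open import Data.Empty using (⊥)
open import Data.Nat using (ℕ)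
open import Data.Fin using (Fin)
open import Data.List using (List; []; _∷_; foldr)
open import Data.Product using (Σ; _×_; _,_; proj₁; proj₂; ∃)
open import Algebra.Bundles using (Group)
open import Function.Bundles using (Equivalence)
open import Relation.Binary.PropositionalEquality using (_≡_; refl; sym; subst)

data Gen : Set where
  ga gb : Gen

-- a letter is a generator with a sign (true = positive, false = inverse)
Letter : Set
Letter = Gen × Bool

_==g_ : Gen → Gen → Bool
ga ==g ga = true
gb ==g gb = true
_  ==g _  = false

cancels : Letter → Letter → Bool
cancels (g , s) (h , t) = (g ==g h) ∧ (s xor t)

isReduced : List Letter → Bool
isReduced []            = true
isReduced (x ∷ [])      = true
isReduced (x ∷ y ∷ w)   = not (cancels x y) ∧ isReduced (y ∷ w)

push : Letter → List Letter → List Letter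
push x []      = x ∷ []
push x (y ∷ w) = if cancels x y then w else (x ∷ y ∷ w)

private
  tail-red : ∀ y w → T (isReduced (y ∷ w)) → T (isReduced w)
  tail-red y []      _ = tt
  tail-red y (z ∷ w) p = proj₂ (Equivalence.to T-∧ p)

  cons-red : ∀ x y w → T (not (cancels x y)) → T (isReduced (y ∷ w))
           → T (isReduced (x ∷ y ∷ w))
  cons-red x y w p q = Equivalence.from T-∧ (p , q)


push-red : ∀ x w → T (isReduced w) → T (isReduced (push x w))
push-red x []      _ = tt
push-red x (y ∷ w) r with cancels x y in eq
... | true  = tail-red y w r
... | false = cons-red x y w (subst (λ c → T (not c)) (sym eq) tt) r

F₂ : Set
F₂ = Σ (List Letter) (λ w → T (isReduced w))

word : F₂ → List Letter
word = proj₁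

pushF : Letter → F₂ → F₂
pushF x (w , r) = push x w , push-red x w r

ε : F₂
ε = [] , tt

_·_ : F₂ → F₂ → F₂
u · v = foldr pushF v (word u)

infixl 7 _·_

letter : Letter → F₂
letter x = pushF x ε

a b a⁻¹ b⁻¹ : F₂
a   = letter (ga , true)
b   = letter (gb , true)
a⁻¹ = letter (ga , false)
b⁻¹ = letter (gb , false)

endo : F₂ → F₂ → F₂ → F₂
endo ia ib u = foldr (λ x acc → img x · acc) ε (word u)
  where
    inv : F₂ → F₂
    inv v = foldr (λ x acc → acc · letter (proj₁ x , not (proj₂ x))) ε (word v)
    img : Letter → F₂
    img (ga , true)  = ia
    img (ga , false) = inv ia
    img (gb , true)  = ib
    img (gb , false) = inv ib

R-letter : Letter → F₂ → F₂
R-letter (ga , true)  = endo a (b · a)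
R-letter (ga , false) = endo a (b · a⁻¹)
R-letter (gb , true)  = endo (a · b) b
R-letter (gb , false) = endo (a · b⁻¹) b

R : F₂ → F₂ → F₂
R w x = foldr (λ l f y → R-letter l (f y)) (λ y → y) (word w) x

Pal : F₂ → F₂
Pal w = b⁻¹ · a⁻¹ · R w (a · b)

record FiniteImage : Set₁ where
  field
    G      : Group 0ℓ 0ℓ
  open Group G public using (Carrier; _≈_; _∙_)
  field
    size   : ℕ
    enum   : Fin size → Carrier
    enum-onto : ∀ g → ∃ λ i → enum i ≈ g
    φ      : F₂ → Carrier
    φ-hom  : ∀ x y → φ (x · y) ≈ φ x ∙ φ y

-- Open sets of the profinite topology: the coarsest topology making every
-- homomorphism to a finite discrete group continuous.  Its open sets are
-- exactly the unions of fibres of such homomorphisms (a finite intersection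
-- of fibres is a fibre of the product homomorphism).
IsOpen : (F₂ → Set) → Set₁
IsOpen U = ∀ x → U x →
  Σ FiniteImage λ H → ∀ y → FiniteImage._≈_ H (FiniteImage.φ H y) (FiniteImage.φ H x) → U y

ProfinitelyContinuous : (F₂ → F₂) → Set₁
ProfinitelyContinuous f = ∀ (U : F₂ → Set) → IsOpen U → IsOpen (λ x → U (f x))

{-# OPTIONS --safe #-}
-- Pal is a crossed homomorphism for the action w ↦ R_w: Pal(uv) = Pal(u) · R_u(Pal(v)).
-- Given φ : F₂ → G with G finite, call u ~ v when every homomorphism ψ : F₂ → G satisfies
-- ψ ∘ R_u = ψ ∘ R_v and ψ(Pal u) = ψ(Pal v). The cocycle identity makes ~ a congruence, and
-- ~ has finitely many classes, since the class of u is determined by the values of the |G|²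
-- homomorphisms ψ on R_u(a), R_u(b) and Pal(u). As φ ∘ Pal is constant on classes, the preimage
-- under Pal of a fibre of φ is a union of fibres of the finite quotient map F₂ → F₂/~.
-- Each class is represented by a word of bounded length, found by pigeonhole on suffixes.
module Submission where

open import Level using (Level; 0ℓ; _⊔_)
open import Data.Bool using (true; false; T; not)
open import Data.Bool.Properties using (T-irrelevant; T-∧; not-involutive)
open import Data.Unit using (tt)
open import Data.Empty using (⊥-elim)
open import Data.List using (List; []; _∷_; foldr; length; _++_; take; drop; lookup; cartesianProductWith)
open import Data.List.Properties using (take++drop≡id; length-take; length-drop)
open import Data.List.Membership.Propositional using (_∈_)
open import Data.List.Membership.Propositional.Properties using (∈-cartesianProductWith⁺)
open import Data.List.Relation.Unary.Any using (here; there; index)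
open import Data.List.Relation.Unary.Any.Properties using (lookup-index)
open import Data.Nat using (ℕ; zero; suc; _≤_; _<_; _+_; _∸_; _*_; _^_; _⊓_; _≤?_; z≤n; s≤s; s≤s⁻¹)
open import Data.Nat.Properties
  using (≤-refl; ≤-trans; <⇒≤; ≰⇒>; n<1+n; m≤n⇒m≤1+n; +-monoˡ-≤; +-monoˡ-<; m⊓n≤m; m+[n∸m]≡n; module ≤-Reasoning)
open import Data.Fin using (Fin; toℕ; combine; remQuot; funToFin; finToFun)
open import Data.Fin.Properties using (pigeonhole; toℕ<n; remQuot-combine; combine-injective; finToFun-funToFin)
open import Relation.Nullary using (yes; no)
open import Relation.Binary using (Rel; IsEquivalence; Setoid)
open import Algebra.Definitions using (Congruent₂)
open import Algebra.Structures using (IsGroup)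
open import Data.Product using (Σ; _×_; _,_; proj₁; proj₂; uncurry)
open import Function.Bundles using (Equivalence)
open import Relation.Binary.PropositionalEquality
  using (_≡_; refl; sym; trans; cong; cong₂; subst; isEquivalence; module ≡-Reasoning)
open import Algebra.Bundles using (Group)
open import Defs

Reduced : List Letter → Set
Reduced w = T (isReduced w)

word-injective : {u v : F₂} → word u ≡ word v → u ≡ v
word-injective {w , r} {.w , r′} refl = cong (w ,_) (T-irrelevant r r′)

reduced-tail : ∀ x w → Reduced (x ∷ w) → Reduced w
reduced-tail x []      _ = tt
reduced-tail x (y ∷ w) r = proj₂ (Equivalence.to T-∧ r)

reduced-head : ∀ x y w → Reduced (x ∷ y ∷ w) → cancels x y ≡ false
reduced-head x y w r with cancels x y
... | false = refl
... | true  = ⊥-elim r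

push-reduced : ∀ x w → Reduced (x ∷ w) → push x w ≡ x ∷ w
push-reduced x []      _ = refl
push-reduced x (y ∷ w) r rewrite reduced-head x y w r = refl

cons≡pushF : ∀ x w (r : Reduced (x ∷ w)) → (x ∷ w , r) ≡ pushF x (w , reduced-tail x w r)
cons≡pushF x w r = word-injective (sym (push-reduced x w r))

invert : Letter → Letter
invert (g , s) = g , not s

invert-involutive : ∀ x → invert (invert x) ≡ x
invert-involutive (g , s) = cong (g ,_) (not-involutive s)

cancels⇒≡invert : ∀ x y → cancels x y ≡ true → y ≡ invert x
cancels⇒≡invert (ga , true)  (ga , false) _ = refl
cancels⇒≡invert (ga , false) (ga , true)  _ = refl
cancels⇒≡invert (gb , true)  (gb , false) _ = refl
cancels⇒≡invert (gb , false) (gb , true)  _ = refl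
cancels⇒≡invert (ga , true)  (ga , true)  ()
cancels⇒≡invert (ga , false) (ga , false) ()
cancels⇒≡invert (gb , true)  (gb , true)  ()
cancels⇒≡invert (gb , false) (gb , false) ()
cancels⇒≡invert (ga , _)     (gb , _)     ()
cancels⇒≡invert (gb , _)     (ga , _)     ()

cancels-invertʳ : ∀ x → cancels x (invert x) ≡ true
cancels-invertʳ (ga , true)  = refl
cancels-invertʳ (ga , false) = refl
cancels-invertʳ (gb , true)  = refl
cancels-invertʳ (gb , false) = refl

cancels-invertˡ : ∀ x → cancels (invert x) x ≡ true
cancels-invertˡ (ga , true)  = refl
cancels-invertˡ (ga , false) = refl
cancels-invertˡ (gb , true)  = refl
cancels-invertˡ (gb , false) = refl

push-invert-cons : ∀ x w → push (invert x) (x ∷ w) ≡ w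
push-invert-cons x w rewrite cancels-invertˡ x = refl

push-invert-push : ∀ x w → Reduced w → push (invert x) (push x w) ≡ w
push-invert-push x []      _ = push-invert-cons x []
push-invert-push x (y ∷ w) r with cancels x y in eq
... | true  rewrite cancels⇒≡invert x y eq = push-reduced (invert x) w r
... | false = push-invert-cons x (y ∷ w)

push-cancel : ∀ x y w → cancels x y ≡ true → Reduced w → push x (push y w) ≡ w
push-cancel x y w c r with refl ← cancels⇒≡invert x y c =
  subst (λ z → push z (push (invert x) w) ≡ w) (invert-involutive x) (push-invert-push (invert x) w r)

mul : List Letter → List Letter → List Letter
mul l w = foldr push w l

mul-reduced : ∀ l w → Reduced w → Reduced (mul l w)
mul-reduced []      w r = r
mul-reduced (x ∷ l) w r = push-red x (mul l w) (mul-reduced l w r)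

mul-push : ∀ x l w → Reduced l → Reduced w → mul (push x l) w ≡ push x (mul l w)
mul-push x []      w _  _  = refl
mul-push x (y ∷ l) w rl rw with cancels x y in eq
... | true  = sym (push-cancel x y (mul l w) eq (mul-reduced l w rw))
... | false = refl

mul-assoc : ∀ l v w → Reduced v → Reduced w → mul (mul l v) w ≡ mul l (mul v w)
mul-assoc []      v w rv rw = refl
mul-assoc (x ∷ l) v w rv rw =
  trans (mul-push x (mul l v) w (mul-reduced l v rv) rw) (cong (push x) (mul-assoc l v w rv rw))

mul-identityʳ : ∀ l → Reduced l → mul l [] ≡ l
mul-identityʳ []      _ = refl
mul-identityʳ (x ∷ l) r = trans (cong (push x) (mul-identityʳ l (reduced-tail x l r))) (push-reduced x l r)

mul-++ : ∀ l w → Reduced (l ++ w) → mul l w ≡ l ++ w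
mul-++ []      w _ = refl
mul-++ (x ∷ l) w r = trans (cong (push x) (mul-++ l w (reduced-tail x (l ++ w) r))) (push-reduced x (l ++ w) r)

word-· : ∀ u v → word (u · v) ≡ mul (word u) (word v)
word-· (l , _) v = go l
  where
  go : ∀ l → word (foldr pushF v l) ≡ mul l (word v)
  go []      = refl
  go (x ∷ l) = cong (push x) (go l)

·-assoc : ∀ u v w → (u · v) · w ≡ u · (v · w)
·-assoc u v w = word-injective (begin
  word ((u · v) · w)                   ≡⟨ word-· (u · v) w ⟩
  mul (word (u · v)) (word w)          ≡⟨ cong (λ l → mul l (word w)) (word-· u v) ⟩
  mul (mul (word u) (word v)) (word w) ≡⟨ mul-assoc (word u) (word v) (word w) (proj₂ v) (proj₂ w) ⟩
  mul (word u) (mul (word v) (word w)) ≡⟨ cong (mul (word u)) (word-· v w) ⟨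
  mul (word u) (word (v · w))          ≡⟨ word-· u (v · w) ⟨
  word (u · (v · w))                   ∎)
  where open ≡-Reasoning

·-identityʳ : ∀ u → u · ε ≡ u
·-identityʳ u = word-injective (trans (word-· u ε) (mul-identityʳ (word u) (proj₂ u)))

letter-·-invert : ∀ x → letter x · letter (invert x) ≡ ε
letter-·-invert x = word-injective (push-cancel x (invert x) [] (cancels-invertʳ x) tt)

infix 8 _⁻¹

_⁻¹ : F₂ → F₂
u ⁻¹ = foldr (λ x acc → acc · letter (invert x)) ε (word u)

·-inverseʳ : ∀ u → u · u ⁻¹ ≡ ε
·-inverseʳ (l , r) = go l r
  where
  open ≡-Reasoning
  go : ∀ l (r : Reduced l) → (l , r) · (l , r) ⁻¹ ≡ ε
  go []      _ = refl
  go (x ∷ l) r = begin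
    pushF x (t · (t ⁻¹ · letter (invert x))) ≡⟨ cong (pushF x) (·-assoc t (t ⁻¹) (letter (invert x))) ⟨
    pushF x ((t · t ⁻¹) · letter (invert x)) ≡⟨ cong (λ s → pushF x (s · letter (invert x))) (go l (reduced-tail x l r)) ⟩
    pushF x (letter (invert x))              ≡⟨ letter-·-invert x ⟩
    ε                                        ∎
    where t = (l , reduced-tail x l r)

·-inverseˡ : ∀ u → u ⁻¹ · u ≡ ε
·-inverseˡ (l , r) = go l r
  where
  open ≡-Reasoning
  go : ∀ l (r : Reduced l) → (l , r) ⁻¹ · (l , r) ≡ ε
  go []      _ = refl
  go (x ∷ l) r = begin
    (t ⁻¹ · letter (invert x)) · (x ∷ l , r)  ≡⟨ ·-assoc (t ⁻¹) (letter (invert x)) (x ∷ l , r) ⟩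
    t ⁻¹ · pushF (invert x) (x ∷ l , r)        ≡⟨ cong (λ s → t ⁻¹ · pushF (invert x) s) (cons≡pushF x l r) ⟩
    t ⁻¹ · pushF (invert x) (pushF x t)        ≡⟨ cong (t ⁻¹ ·_) (word-injective (push-invert-push x l (proj₂ t))) ⟩
    t ⁻¹ · t                                   ≡⟨ go l (proj₂ t) ⟩
    ε                                          ∎
    where t = (l , reduced-tail x l r)

F₂-group : Group 0ℓ 0ℓ
F₂-group = record
  { Carrier = F₂ ; _≈_ = _≡_ ; _∙_ = _·_ ; ε = ε ; _⁻¹ = _⁻¹
  ; isGroup = record
    { isMonoid = record
      { isSemigroup = record
        { isMagma = record { isEquivalence = isEquivalence ; ∙-cong = cong₂ _·_ }
        ; assoc = ·-assoc }
      ; identity = (λ _ → refl) , ·-identityʳ }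
    ; inverse = ·-inverseˡ , ·-inverseʳ
    ; ⁻¹-cong = cong _⁻¹ } }

module Eval {c ℓ : Level} (G : Group c ℓ) where
  open Group G renaming (ε to 1G; _⁻¹ to _⁻¹ᴳ; refl to ≈-refl; sym to ≈-sym; trans to ≈-trans)
  open import Algebra.Properties.Group G using (identityˡ-unique; inverseʳ-unique)
  open import Relation.Binary.Reasoning.Setoid setoid

  assign : Carrier → Carrier → Letter → Carrier
  assign g h (ga , true)  = g
  assign g h (ga , false) = g ⁻¹ᴳ
  assign g h (gb , true)  = h
  assign g h (gb , false) = h ⁻¹ᴳ

  assign-invert : ∀ g h x → assign g h x ∙ assign g h (invert x) ≈ 1G
  assign-invert g h (ga , true)  = inverseʳ g
  assign-invert g h (ga , false) = inverseˡ g
  assign-invert g h (gb , true)  = inverseʳ h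
  assign-invert g h (gb , false) = inverseˡ h

  assign-cong : ∀ {g g′ h h′} → g ≈ g′ → h ≈ h′ → ∀ x → assign g h x ≈ assign g′ h′ x
  assign-cong g≈g′ h≈h′ (ga , true)  = g≈g′
  assign-cong g≈g′ h≈h′ (ga , false) = ⁻¹-cong g≈g′
  assign-cong g≈g′ h≈h′ (gb , true)  = h≈h′
  assign-cong g≈g′ h≈h′ (gb , false) = ⁻¹-cong h≈h′

  evalWord : Carrier → Carrier → List Letter → Carrier
  evalWord g h = foldr (λ x acc → assign g h x ∙ acc) 1G

  eval : Carrier → Carrier → F₂ → Carrier
  eval g h u = evalWord g h (word u)

  evalWord-push : ∀ g h x l → evalWord g h (push x l) ≈ assign g h x ∙ evalWord g h l
  evalWord-push g h x []      = ≈-refl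
  evalWord-push g h x (y ∷ l) with cancels x y in eq
  ... | false = ≈-refl
  ... | true with refl ← cancels⇒≡invert x y eq = ≈-sym (begin
    assign g h x ∙ (assign g h (invert x) ∙ evalWord g h l) ≈⟨ assoc _ _ _ ⟨
    (assign g h x ∙ assign g h (invert x)) ∙ evalWord g h l ≈⟨ ∙-congʳ (assign-invert g h x) ⟩
    1G ∙ evalWord g h l                                     ≈⟨ identityˡ _ ⟩
    evalWord g h l                                          ∎)

  evalWord-mul : ∀ g h l v → evalWord g h (mul l v) ≈ evalWord g h l ∙ evalWord g h v
  evalWord-mul g h []      v = ≈-sym (identityˡ _)
  evalWord-mul g h (x ∷ l) v = begin
    evalWord g h (push x (mul l v))                      ≈⟨ evalWord-push g h x (mul l v) ⟩
    assign g h x ∙ evalWord g h (mul l v)                ≈⟨ ∙-congˡ (evalWord-mul g h l v) ⟩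
    assign g h x ∙ (evalWord g h l ∙ evalWord g h v)     ≈⟨ assoc _ _ _ ⟨
    (assign g h x ∙ evalWord g h l) ∙ evalWord g h v     ∎

  eval-· : ∀ g h u v → eval g h (u · v) ≈ eval g h u ∙ eval g h v
  eval-· g h u v = begin
    evalWord g h (word (u · v))           ≡⟨ cong (evalWord g h) (word-· u v) ⟩
    evalWord g h (mul (word u) (word v))  ≈⟨ evalWord-mul g h (word u) (word v) ⟩
    eval g h u ∙ eval g h v               ∎

  eval-cong : ∀ {g g′ h h′} → g ≈ g′ → h ≈ h′ → ∀ u → eval g h u ≈ eval g′ h′ u
  eval-cong g≈g′ h≈h′ u = go (word u)
    where
    go : ∀ l → evalWord _ _ l ≈ evalWord _ _ l
    go []      = ≈-refl
    go (x ∷ l) = ∙-cong (assign-cong g≈g′ h≈h′ x) (go l)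

  IsHom : (F₂ → Carrier) → Set ℓ
  IsHom f = ∀ u v → f (u · v) ≈ f u ∙ f v

  module _ {f : F₂ → Carrier} (f-hom : IsHom f) where

    hom-ε : f ε ≈ 1G
    hom-ε = identityˡ-unique (f ε) (f ε) (≈-sym (f-hom ε ε))

    hom-invert : ∀ x → f (letter (invert x)) ≈ f (letter x) ⁻¹ᴳ
    hom-invert x = inverseʳ-unique _ _ (begin
      f (letter x) ∙ f (letter (invert x)) ≈⟨ f-hom (letter x) (letter (invert x)) ⟨
      f (letter x · letter (invert x))     ≡⟨ cong f (letter-·-invert x) ⟩
      f ε                                  ≈⟨ hom-ε ⟩
      1G                                   ∎)

    hom-letter : ∀ x → f (letter x) ≈ assign (f a) (f b) x
    hom-letter (ga , true)  = ≈-refl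
    hom-letter (ga , false) = hom-invert (ga , true)
    hom-letter (gb , true)  = ≈-refl
    hom-letter (gb , false) = hom-invert (gb , true)

    hom≈eval : ∀ u → f u ≈ eval (f a) (f b) u
    hom≈eval (l , r) = go l r
      where
      go : ∀ l (r : Reduced l) → f (l , r) ≈ evalWord (f a) (f b) l
      go []      _ = hom-ε
      go (x ∷ l) r = begin
        f (x ∷ l , r)                   ≡⟨ cong f (cons≡pushF x l r) ⟩
        f (letter x · t)                ≈⟨ f-hom (letter x) t ⟩
        f (letter x) ∙ f t              ≈⟨ ∙-cong (hom-letter x) (go l (proj₂ t)) ⟩
        assign (f a) (f b) x ∙ evalWord (f a) (f b) l ∎
        where t = (l , reduced-tail x l r)

module Free = Eval F₂-group

endo≡eval : ∀ ia ib u → endo ia ib u ≡ Free.eval ia ib u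
endo≡eval ia ib (l , r) = go l r
  where
  go : ∀ l (r : Reduced l) → endo ia ib (l , r) ≡ Free.evalWord ia ib l
  go []                 _ = refl
  go ((ga , true)  ∷ l) r = cong (ia ·_) (go l (reduced-tail _ l r))
  go ((ga , false) ∷ l) r = cong (ia ⁻¹ ·_) (go l (reduced-tail _ l r))
  go ((gb , true)  ∷ l) r = cong (ib ·_) (go l (reduced-tail _ l r))
  go ((gb , false) ∷ l) r = cong (ib ⁻¹ ·_) (go l (reduced-tail _ l r))

endo-isHom : ∀ ia ib → Free.IsHom (endo ia ib)
endo-isHom ia ib u v = begin
  endo ia ib (u · v)                  ≡⟨ endo≡eval ia ib (u · v) ⟩
  Free.eval ia ib (u · v)             ≡⟨ Free.eval-· ia ib u v ⟩
  Free.eval ia ib u · Free.eval ia ib v ≡⟨ cong₂ _·_ (endo≡eval ia ib u) (endo≡eval ia ib v) ⟨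
  endo ia ib u · endo ia ib v         ∎
  where open ≡-Reasoning

eval-generators : ∀ u → Free.eval a b u ≡ u
eval-generators (l , r) = go l r
  where
  assign-generators : ∀ x v → Free.assign a b x · v ≡ pushF x v
  assign-generators (ga , true)  v = refl
  assign-generators (ga , false) v = refl
  assign-generators (gb , true)  v = refl
  assign-generators (gb , false) v = refl
  go : ∀ l (r : Reduced l) → Free.evalWord a b l ≡ (l , r)
  go []      _ = refl
  go (x ∷ l) r = trans (assign-generators x _)
    (trans (cong (pushF x) (go l (reduced-tail x l r))) (sym (cons≡pushF x l r)))

hom-fixing-generators≡id : ∀ {f} → Free.IsHom f → f a ≡ a → f b ≡ b → ∀ u → f u ≡ u
hom-fixing-generators≡id f-hom fa≡a fb≡b u =
  trans (Free.hom≈eval f-hom u) (trans (cong₂ (λ g h → Free.eval g h u) fa≡a fb≡b) (eval-generators u))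

R-letter-isHom : ∀ x → Free.IsHom (R-letter x)
R-letter-isHom (ga , true)  = endo-isHom _ _
R-letter-isHom (ga , false) = endo-isHom _ _
R-letter-isHom (gb , true)  = endo-isHom _ _
R-letter-isHom (gb , false) = endo-isHom _ _

R-letter-invert : ∀ x u → R-letter x (R-letter (invert x) u) ≡ u
R-letter-invert x = hom-fixing-generators≡id
  (λ u v → trans (cong (R-letter x) (R-letter-isHom (invert x) u v)) (R-letter-isHom x _ _))
  (fixes-a x) (fixes-b x)
  where
  fixes-a : ∀ x → R-letter x (R-letter (invert x) a) ≡ a
  fixes-a (ga , true)  = refl
  fixes-a (ga , false) = refl
  fixes-a (gb , true)  = refl
  fixes-a (gb , false) = refl
  fixes-b : ∀ x → R-letter x (R-letter (invert x) b) ≡ b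
  fixes-b (ga , true)  = refl
  fixes-b (ga , false) = refl
  fixes-b (gb , true)  = refl
  fixes-b (gb , false) = refl

Rw : List Letter → F₂ → F₂
Rw l = foldr (λ x f y → R-letter x (f y)) (λ y → y) l

Rw-isHom : ∀ l → Free.IsHom (Rw l)
Rw-isHom []      u v = refl
Rw-isHom (x ∷ l) u v = trans (cong (R-letter x) (Rw-isHom l u v)) (R-letter-isHom x (Rw l u) (Rw l v))

Rw-push : ∀ x l u → Rw (push x l) u ≡ R-letter x (Rw l u)
Rw-push x []      u = refl
Rw-push x (y ∷ l) u with cancels x y in eq
... | false = refl
... | true with refl ← cancels⇒≡invert x y eq = sym (R-letter-invert x (Rw l u))

Rw-mul : ∀ l v u → Rw (mul l v) u ≡ Rw l (Rw v u)
Rw-mul []      v u = refl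
Rw-mul (x ∷ l) v u = trans (Rw-push x (mul l v) u) (cong (R-letter x) (Rw-mul l v u))

R-isHom : ∀ u → Free.IsHom (R u)
R-isHom u = Rw-isHom (word u)

R-· : ∀ u v t → R (u · v) t ≡ R u (R v t)
R-· u v t = trans (cong (λ l → Rw l t) (word-· u v)) (Rw-mul (word u) (word v) t)

Pal-· : ∀ u v → Pal (u · v) ≡ Pal u · R u (Pal v)
Pal-· u v = sym (begin
  (c · R u ab) · R u (c · R v ab)       ≡⟨ cong ((c · R u ab) ·_) (R-isHom u c (R v ab)) ⟩
  (c · R u ab) · (R u c · R u (R v ab)) ≡⟨ ·-assoc c (R u ab) _ ⟩
  c · (R u ab · (R u c · R u (R v ab))) ≡⟨ cong (c ·_) (·-assoc (R u ab) (R u c) _) ⟨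
  c · ((R u ab · R u c) · R u (R v ab)) ≡⟨ cong (λ t → c · (t · R u (R v ab))) (R-isHom u ab c) ⟨
  -- ab · c computes to ε
  c · (R u ε · R u (R v ab))            ≡⟨ cong (λ t → c · (t · R u (R v ab))) (Free.hom-ε {R u} (R-isHom u)) ⟩
  c · R u (R v ab)                      ≡⟨ cong (c ·_) (R-· u v ab) ⟨
  c · R (u · v) ab                      ∎)
  where
  open ≡-Reasoning
  c ab : F₂
  c  = b⁻¹ · a⁻¹
  ab = a · b

module PalCongruence {c ℓ : Level} (G : Group c ℓ) where
  open Group G using (_≈_; _∙_; ∙-cong; reflexive; setoid) renaming (refl to ≈-refl; sym to ≈-sym; trans to ≈-trans)
  open Eval G

  infix 4 _≋_ _~_

  record _≋_ (w w′ : F₂) : Set (c ⊔ ℓ) where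
    constructor agree
    field eval-≈ : ∀ g h → eval g h w ≈ eval g h w′
  open _≋_

  ≋-isEquivalence : IsEquivalence _≋_
  ≋-isEquivalence = record
    { refl  = agree λ g h → ≈-refl
    ; sym   = λ w≋w′ → agree λ g h → ≈-sym (eval-≈ w≋w′ g h)
    ; trans = λ w≋w′ w′≋w″ → agree λ g h → ≈-trans (eval-≈ w≋w′ g h) (eval-≈ w′≋w″ g h)
    }

  ≋-setoid : Setoid 0ℓ (c ⊔ ℓ)
  ≋-setoid = record { isEquivalence = ≋-isEquivalence }

  open IsEquivalence ≋-isEquivalence using () renaming (refl to ≋-refl; sym to ≋-sym; trans to ≋-trans)

  ·-≋ : Congruent₂ _≋_ _·_
  ·-≋ {w} {w′} {z} {z′} w≋w′ z≋z′ = agree λ g h → begin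
    eval g h (w · z)            ≈⟨ eval-· g h w z ⟩
    eval g h w ∙ eval g h z     ≈⟨ ∙-cong (eval-≈ w≋w′ g h) (eval-≈ z≋z′ g h) ⟩
    eval g h w′ ∙ eval g h z′   ≈⟨ eval-· g h w′ z′ ⟨
    eval g h (w′ · z′)          ∎
    where open import Relation.Binary.Reasoning.Setoid setoid

  eval-R : ∀ u g h t → eval g h (R u t) ≈ eval (eval g h (R u a)) (eval g h (R u b)) t
  eval-R u g h = hom≈eval {f = λ t → eval g h (R u t)}
    (λ v w → ≈-trans (reflexive (cong (eval g h) (R-isHom u v w))) (eval-· g h (R u v) (R u w)))

  R-≋ : ∀ u {w w′} → w ≋ w′ → R u w ≋ R u w′
  R-≋ u {w} {w′} w≋w′ = agree λ g h →
    ≈-trans (eval-R u g h w) (≈-trans (eval-≈ w≋w′ _ _) (≈-sym (eval-R u g h w′)))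

  record _~_ (u v : F₂) : Set (c ⊔ ℓ) where
    field
      R-a : R u a ≋ R v a
      R-b : R u b ≋ R v b
      Pal-≋ : Pal u ≋ Pal v
  open _~_

  ~⇒R-≋ : ∀ {u v} → u ~ v → ∀ t → R u t ≋ R v t
  ~⇒R-≋ {u} {v} u~v t = agree λ g h → begin
    eval g h (R u t)                                     ≈⟨ eval-R u g h t ⟩
    eval (eval g h (R u a)) (eval g h (R u b)) t         ≈⟨ eval-cong (eval-≈ (R-a u~v) g h) (eval-≈ (R-b u~v) g h) t ⟩
    eval (eval g h (R v a)) (eval g h (R v b)) t         ≈⟨ eval-R v g h t ⟨
    eval g h (R v t)                                     ∎
    where open import Relation.Binary.Reasoning.Setoid setoid

  ~-isEquivalence : IsEquivalence _~_
  ~-isEquivalence = record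
    { refl  = record { R-a = ≋-refl ; R-b = ≋-refl ; Pal-≋ = ≋-refl }
    ; sym   = λ p → record { R-a = ≋-sym (R-a p) ; R-b = ≋-sym (R-b p) ; Pal-≋ = ≋-sym (Pal-≋ p) }
    ; trans = λ p q → record
      { R-a = ≋-trans (R-a p) (R-a q) ; R-b = ≋-trans (R-b p) (R-b q) ; Pal-≋ = ≋-trans (Pal-≋ p) (Pal-≋ q) }
    }

  ~-· : Congruent₂ _~_ _·_
  ~-· {u} {u′} {v} {v′} u~u′ v~v′ = record { R-a = R-·-≋ a ; R-b = R-·-≋ b ; Pal-≋ = Pal-·-≋ }
    where
    open import Relation.Binary.Reasoning.Setoid ≋-setoid
    R-·-≋ : ∀ t → R (u · v) t ≋ R (u′ · v′) t
    R-·-≋ t = begin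
      R (u · v) t     ≡⟨ R-· u v t ⟩
      R u (R v t)     ≈⟨ ~⇒R-≋ u~u′ (R v t) ⟩
      R u′ (R v t)    ≈⟨ R-≋ u′ (~⇒R-≋ v~v′ t) ⟩
      R u′ (R v′ t)   ≡⟨ R-· u′ v′ t ⟨
      R (u′ · v′) t   ∎
    Pal-·-≋ : Pal (u · v) ≋ Pal (u′ · v′)
    Pal-·-≋ = begin
      Pal (u · v)               ≡⟨ Pal-· u v ⟩
      Pal u · R u (Pal v)       ≈⟨ ·-≋ (Pal-≋ u~u′) (~⇒R-≋ u~u′ (Pal v)) ⟩
      Pal u′ · R u′ (Pal v)     ≈⟨ ·-≋ (≋-refl {Pal u′}) (R-≋ u′ (Pal-≋ v~v′)) ⟩
      Pal u′ · R u′ (Pal v′)    ≡⟨ Pal-· u′ v′ ⟨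
      Pal (u′ · v′)             ∎

prefix-reduced : ∀ l w → Reduced (l ++ w) → Reduced l
prefix-reduced []          w _ = tt
prefix-reduced (x ∷ [])    w _ = tt
prefix-reduced (x ∷ y ∷ l) w r =
  Equivalence.from T-∧ (proj₁ (Equivalence.to T-∧ r) , prefix-reduced (y ∷ l) w (reduced-tail x (y ∷ l ++ w) r))

drop-reduced : ∀ k l → Reduced l → Reduced (drop k l)
drop-reduced zero    l       r = r
drop-reduced (suc k) []      r = r
drop-reduced (suc k) (x ∷ l) r = drop-reduced k l (reduced-tail x l r)

prefix suffix : ℕ → F₂ → F₂
prefix k (l , r) = take k l , prefix-reduced (take k l) (drop k l) (subst Reduced (sym (take++drop≡id k l)) r)
suffix k (l , r) = drop k l , drop-reduced k l r

prefix-·-suffix : ∀ k u → prefix k u · suffix k u ≡ u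
prefix-·-suffix k (l , r) = word-injective (begin
  word (prefix k (l , r) · suffix k (l , r)) ≡⟨ word-· (prefix k (l , r)) (suffix k (l , r)) ⟩
  mul (take k l) (drop k l)                  ≡⟨ mul-++ (take k l) (drop k l) (subst Reduced (sym (take++drop≡id k l)) r) ⟩
  take k l ++ drop k l                       ≡⟨ take++drop≡id k l ⟩
  l                                          ∎)
  where open ≡-Reasoning

length-push : ∀ x l → length (push x l) ≤ suc (length l)
length-push x []      = ≤-refl
length-push x (y ∷ l) with cancels x y
... | true  = m≤n⇒m≤1+n (m≤n⇒m≤1+n ≤-refl)
... | false = ≤-refl

length-mul : ∀ l w → length (mul l w) ≤ length l + length w
length-mul []      w = ≤-refl
length-mul (x ∷ l) w = ≤-trans (length-push x (mul l w)) (s≤s (length-mul l w))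

length-prefix-·-suffix : ∀ {i j} u → i < j → j ≤ length (word u) →
                         length (word (prefix i u · suffix j u)) < length (word u)
length-prefix-·-suffix {i} {j} u@(l , _) i<j j≤L = begin-strict
  length (word (prefix i u · suffix j u))  ≡⟨ cong length (word-· (prefix i u) (suffix j u)) ⟩
  length (mul (take i l) (drop j l))       ≤⟨ length-mul (take i l) (drop j l) ⟩
  length (take i l) + length (drop j l)    ≡⟨ cong₂ _+_ (length-take i l) (length-drop j l) ⟩
  i ⊓ length l + (length l ∸ j)            ≤⟨ +-monoˡ-≤ (length l ∸ j) (m⊓n≤m i (length l)) ⟩
  i + (length l ∸ j)                       <⟨ +-monoˡ-< (length l ∸ j) i<j ⟩
  j + (length l ∸ j)                       ≡⟨ m+[n∸m]≡n j≤L ⟩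
  length l                                 ∎
  where open ≤-Reasoning

letters : List Letter
letters = (ga , true) ∷ (ga , false) ∷ (gb , true) ∷ (gb , false) ∷ []

∈-letters : ∀ x → x ∈ letters
∈-letters (ga , true)  = here refl
∈-letters (ga , false) = there (here refl)
∈-letters (gb , true)  = there (there (here refl))
∈-letters (gb , false) = there (there (there (here refl)))

words≤ : ℕ → List F₂
words≤ zero    = ε ∷ []
words≤ (suc n) = ε ∷ cartesianProductWith pushF letters (words≤ n)

∈-words≤ : ∀ n u → length (word u) ≤ n → u ∈ words≤ n
∈-words≤ zero    ([] , _) _ = here refl
∈-words≤ (suc n) ([] , _) _ = here refl
∈-words≤ (suc n) (x ∷ l , r) (s≤s |l|≤n) = there (subst (_∈ cartesianProductWith pushF letters (words≤ n))
  (sym (cons≡pushF x l r))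
  (∈-cartesianProductWith⁺ pushF (∈-letters x) (∈-words≤ n (l , reduced-tail x l r) |l|≤n)))

module Quotient {_~_ : Rel F₂ 0ℓ} (~-isEquivalence : IsEquivalence _~_) (~-· : Congruent₂ _~_ _·_) where
  open IsEquivalence ~-isEquivalence renaming (refl to ~-refl; sym to ~-sym; trans to ~-trans; reflexive to ≡⇒~)

  ~-setoid : Setoid 0ℓ 0ℓ
  ~-setoid = record { isEquivalence = ~-isEquivalence }

  ⁻¹-cong : ∀ {u v} → u ~ v → (u ⁻¹) ~ (v ⁻¹)
  ⁻¹-cong {u} {v} u~v = begin
    u ⁻¹                ≡⟨ ·-identityʳ (u ⁻¹) ⟨
    u ⁻¹ · ε            ≡⟨ cong (u ⁻¹ ·_) (·-inverseʳ v) ⟨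
    u ⁻¹ · (v · v ⁻¹)   ≈⟨ ~-· (~-refl {u ⁻¹}) (~-· (~-sym u~v) (~-refl {v ⁻¹})) ⟩
    u ⁻¹ · (u · v ⁻¹)   ≡⟨ ·-assoc (u ⁻¹) u (v ⁻¹) ⟨
    (u ⁻¹ · u) · v ⁻¹   ≡⟨ cong (_· v ⁻¹) (·-inverseˡ u) ⟩
    v ⁻¹                ∎
    where open import Relation.Binary.Reasoning.Setoid ~-setoid

  ~-isGroup : IsGroup _~_ _·_ ε _⁻¹
  ~-isGroup = record
    { isMonoid = record
      { isSemigroup = record
        { isMagma = record { isEquivalence = ~-isEquivalence ; ∙-cong = ~-· }
        ; assoc = λ u v w → ≡⇒~ (·-assoc u v w) }
      ; identity = (λ _ → ~-refl) , (λ u → ≡⇒~ (·-identityʳ u)) }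
    ; inverse = (λ u → ≡⇒~ (·-inverseˡ u)) , (λ u → ≡⇒~ (·-inverseʳ u))
    ; ⁻¹-cong = ⁻¹-cong }

  module _ {m} (code : F₂ → Fin m) (code⇒~ : ∀ {u v} → code u ≡ code v → u ~ v) where

    -- Two of the m + 1 first suffixes of u share a code; cutting out the segment between them
    -- shortens u without leaving its class.
    shorten : ∀ u → m < length (word u) → Σ F₂ λ v → length (word v) < length (word u) × v ~ u
    shorten u m<|u| with pigeonhole (n<1+n m) (λ i → code (suffix (toℕ i) u))
    ... | i , j , i<j , same-code = prefix (toℕ i) u · suffix (toℕ j) u , shorter , equivalent
      where
      shorter : length (word (prefix (toℕ i) u · suffix (toℕ j) u)) < length (word u)
      shorter = length-prefix-·-suffix u i<j (≤-trans (s≤s⁻¹ (toℕ<n j)) (<⇒≤ m<|u|))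
      equivalent : (prefix (toℕ i) u · suffix (toℕ j) u) ~ u
      equivalent = ~-trans (~-· (~-refl {prefix (toℕ i) u}) (~-sym (code⇒~ same-code))) (≡⇒~ (prefix-·-suffix (toℕ i) u))

    representative : ∀ n u → length (word u) ≤ n → Σ F₂ λ w → length (word w) ≤ m × w ~ u
    representative n u |u|≤n with length (word u) ≤? m
    ... | yes |u|≤m = u , |u|≤m , ~-refl
    representative zero    u |u|≤0   | no |u|≰m = ⊥-elim (|u|≰m (≤-trans |u|≤0 z≤n))
    representative (suc n) u |u|≤1+n | no |u|≰m =
      let v , |v|<|u| , v~u = shorten u (≰⇒> |u|≰m)
          w , |w|≤m , w~v   = representative n v (s≤s⁻¹ (≤-trans |v|<|u| |u|≤1+n))
      in  w , |w|≤m , ~-trans w~v v~u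

    finiteImage : FiniteImage
    finiteImage = record
      { G         = record { Carrier = F₂ ; _≈_ = _~_ ; _∙_ = _·_ ; ε = ε ; _⁻¹ = _⁻¹ ; isGroup = ~-isGroup }
      ; size      = length (words≤ m)
      ; enum      = lookup (words≤ m)
      ; enum-onto = λ u →
          let w , |w|≤m , w~u = representative (length (word u)) u ≤-refl
              w∈words≤m      = ∈-words≤ m w |w|≤m
          in  index w∈words≤m , ~-trans (≡⇒~ (sym (lookup-index w∈words≤m))) w~u
      ; φ         = λ u → u
      ; φ-hom     = λ _ _ → ~-refl
      }

encodeTable : ∀ {m n k} → (Fin m → Fin n → Fin k) → Fin (k ^ (m * n))
encodeTable {n = n} t = funToFin (λ p → uncurry t (remQuot n p))

encodeTable-injective : ∀ {m n k} {t t′ : Fin m → Fin n → Fin k} →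
                        encodeTable t ≡ encodeTable t′ → ∀ i j → t i j ≡ t′ i j
encodeTable-injective {n = n} {t = t} {t′} same-code i j = begin
  t i j                                      ≡⟨ cong (uncurry t) (remQuot-combine i j) ⟨
  uncurry t (remQuot n (combine i j))        ≡⟨ finToFun-funToFin _ (combine i j) ⟨
  finToFun (encodeTable t) (combine i j)     ≡⟨ cong (λ e → finToFun e (combine i j)) same-code ⟩
  finToFun (encodeTable t′) (combine i j)    ≡⟨ finToFun-funToFin _ (combine i j) ⟩
  uncurry t′ (remQuot n (combine i j))       ≡⟨ cong (uncurry t′) (remQuot-combine i j) ⟩
  t′ i j                                     ∎
  where open ≡-Reasoning

module FiniteIndex (H : FiniteImage) where
  open FiniteImage H using (G; size; enum; enum-onto; φ; φ-hom)
  open Group G using (Carrier; _≈_; setoid)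
  open Eval G
  open PalCongruence G
  open _~_

  classOf : Carrier → Fin size
  classOf g = proj₁ (enum-onto g)

  table : F₂ → Fin size → Fin size → Fin size
  table w i j = classOf (eval (enum i) (enum j) w)

  table⇒≋ : ∀ {w w′} → (∀ i j → table w i j ≡ table w′ i j) → w ≋ w′
  table⇒≋ {w} {w′} same-table = agree λ g h → begin
    eval g h w                                          ≈⟨ eval-cong (enum-classOf g) (enum-classOf h) w ⟨
    eval (enum (classOf g)) (enum (classOf h)) w        ≈⟨ enum-classOf _ ⟨
    enum (table w (classOf g) (classOf h))              ≡⟨ cong enum (same-table (classOf g) (classOf h)) ⟩
    enum (table w′ (classOf g) (classOf h))             ≈⟨ enum-classOf _ ⟩
    eval (enum (classOf g)) (enum (classOf h)) w′       ≈⟨ eval-cong (enum-classOf g) (enum-classOf h) w′ ⟩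
    eval g h w′                                         ∎
    where
    open import Relation.Binary.Reasoning.Setoid setoid
    enum-classOf : ∀ g → enum (classOf g) ≈ g
    enum-classOf g = proj₂ (enum-onto g)

  code : F₂ → Fin _
  code u = combine (encodeTable (table (R u a))) (combine (encodeTable (table (R u b))) (encodeTable (table (Pal u))))

  code⇒~ : ∀ {u v} → code u ≡ code v → u ~ v
  code⇒~ same-code =
    let same-a , same-b-Pal = combine-injective _ _ _ _ same-code
        same-b , same-Pal   = combine-injective _ _ _ _ same-b-Pal
    in  record
      { R-a   = table⇒≋ (encodeTable-injective same-a)
      ; R-b   = table⇒≋ (encodeTable-injective same-b)
      ; Pal-≋ = table⇒≋ (encodeTable-injective same-Pal)
      }

  image : FiniteImage
  image = Quotient.finiteImage ~-isEquivalence ~-· code code⇒~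

  φ∘Pal-respects-~ : ∀ {u v} → u ~ v → φ (Pal u) ≈ φ (Pal v)
  φ∘Pal-respects-~ {u} {v} u~v = begin
    φ (Pal u)                     ≈⟨ hom≈eval φ-hom (Pal u) ⟩
    eval (φ a) (φ b) (Pal u)      ≈⟨ _≋_.eval-≈ (Pal-≋ u~v) (φ a) (φ b) ⟩
    eval (φ a) (φ b) (Pal v)      ≈⟨ hom≈eval φ-hom (Pal v) ⟨
    φ (Pal v)                     ∎
    where open import Relation.Binary.Reasoning.Setoid setoid

theorem6p1 : ProfinitelyContinuous Pal
theorem6p1 U U-open x U[Pal[x]] = image , λ y y~x → fibre⊆U (Pal y) (φ∘Pal-respects-~ y~x)
  where
  H = proj₁ (U-open (Pal x) U[Pal[x]])
  fibre⊆U = proj₂ (U-open (Pal x) U[Pal[x]])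
  open FiniteIndex H
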